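{- Let $\sigma$ be a signature of unary predicate symbols and $x$ a fixed variable. Let $L$ be the smallest set of formulas containing every first-order $\sigma$-formula without the identity symbol whose free variables are among $\{x\}$, and closed under $\neg$, $\vee$, and the operator forming $\langle-\varphi\rangle\psi$ from $\varphi,\psi\in L$. Then $L$ has exactly the expressive power of monadic first-order logic with identity in one free variable $x$: every formula of $L$ is equivalent (over all $\sigma$-structures) to a first-order $\sigma$-formula with identity whose free variables are among $\{x\}$, and every such first-order formula with identity is equivalent to some formula of $L$.
   Context: Formulas of $L$ are evaluated at a structure $\mathcal{M}$ with domain $W$ and an element $s\in W$ (the value of $x$). First-order formulas are evaluated as usual with $x:=s$; Booleans standard; $\mathcal{M},s\models\langle-\varphi\rangle\psi$ iff there is $t\in W$ with $t\neq s$ such that $\mathcal{M},t\models\varphi$ and $\mathcal{M}-\{t\},s\models\psi$, where $\mathcal{M}-\{t\}$ is the substructure with domain $W\setminus\{t\}$. -}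

module Defs where

open import Data.Bool using (Bool; true; false)
open import Data.Nat using (ℕ; zero; suc)
open import Data.Fin using (Fin; zero; suc)
open import Data.Product using (Σ; _×_; _,_)
open import Data.Sum using (_⊎_)
open import Data.Empty using (⊥)
open import Relation.Nullary using (¬_)
open import Relation.Binary.PropositionalEquality using (_≡_; _≢_; sym)
open import Function.Bundles using (_⇔_)

-- The Bool index says whether the identity symbol may occur:
-- FO Sig false n = identity-free formulas, FO Sig true n = formulas with identity
-- (identity-free formulas are just the ones built without _≐_; the
-- other constructors are polymorphic in the flag).
-- Formulas with free variables among {x} are those in FO Sig e 1,
-- variable zero of the empty-bound context being x.
data FO (Sig : Set) : Bool → ℕ → Set where
  ⊥'   : ∀ {e n} → FO Sig e n
  pred : ∀ {e n} → Sig → Fin n → FO Sig e n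
  _≐_  : ∀ {n} → Fin n → Fin n → FO Sig true n
  ¬'_  : ∀ {e n} → FO Sig e n → FO Sig e n
  _∨'_ : ∀ {e n} → FO Sig e n → FO Sig e n → FO Sig e n
  ∃'   : ∀ {e n} → FO Sig e (suc n) → FO Sig e n

record Structure (Sig : Set) : Set₁ where
  field
    W : Set
    P : Sig → W → Set
open Structure public

_∷ᵉ_ : ∀ {W : Set} {n} → W → (Fin n → W) → Fin (suc n) → W
(w ∷ᵉ ρ) zero    = w
(w ∷ᵉ ρ) (suc i) = ρ i

⟦_⟧ : ∀ {Sig e n} → FO Sig e n → (M : Structure Sig) → (Fin n → W M) → Set
⟦ ⊥' ⟧       M ρ = ⊥
⟦ pred p i ⟧ M ρ = P M p (ρ i)
⟦ i ≐ j ⟧    M ρ = ρ i ≡ ρ j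
⟦ ¬' φ ⟧     M ρ = ¬ ⟦ φ ⟧ M ρ
⟦ φ ∨' ψ ⟧   M ρ = ⟦ φ ⟧ M ρ ⊎ ⟦ ψ ⟧ M ρ
⟦ ∃' φ ⟧     M ρ = Σ (W M) λ w → ⟦ φ ⟧ M (w ∷ᵉ ρ)

-- Elements of W other than t.  The proof field is irrelevant, so two
-- elements are equal iff their underlying values are.
record Other {W : Set} (t : W) : Set where
  constructor ⟨_,_⟩
  field
    val : W
    .ne : val ≢ t
open Other public

_-_ : ∀ {Sig} → (M : Structure Sig) → W M → Structure Sig
W (M - t) = Other t
P (M - t) p w = P M p (val w)

data L (Sig : Set) : Set where
  base : FO Sig false 1 → L Sig
  ¬L_  : L Sig → L Sig
  _∨L_ : L Sig → L Sig → L Sig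
  ⟨-_⟩_ : L Sig → L Sig → L Sig

_,_⊨_ : ∀ {Sig} → (M : Structure Sig) → W M → L Sig → Set
M , s ⊨ base φ = ⟦ φ ⟧ M (λ _ → s)
M , s ⊨ (¬L φ) = ¬ (M , s ⊨ φ)
M , s ⊨ (φ ∨L ψ) = (M , s ⊨ φ) ⊎ (M , s ⊨ ψ)
M , s ⊨ (⟨- φ ⟩ ψ) =
  Σ (W M) λ t → Σ (t ≢ s) λ t≢s →
    (M , t ⊨ φ) × ((M - t) , ⟨ s , (λ e → t≢s (sym e)) ⟩ ⊨ ψ)

_≋_ : ∀ {Sig e} → L Sig → FO Sig e 1 → Set₁
_≋_ {Sig} φ χ = (M : Structure Sig) (s : W M) → (M , s ⊨ φ) ⇔ ⟦ χ ⟧ M (λ _ → s)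

-- Both translations track a structure M together with the substructure N left
-- after removing finitely many points t₁ … t_k, all of them named by variables.
-- From L to first-order logic, ⟨- φ ⟩ ψ becomes "there is a point different from
-- x and from the removed points", and identity-free base formulas are relativised
-- to the points not yet removed.  Conversely, a first-order variable always
-- denotes either x or some removed point; a quantifier ranges over these finitely
-- many points plus the fresh points, and a fresh witness is removed by ⟨-_⟩ after
-- its colour on the relevant predicates has been recorded, so that later atoms
-- and identities about the removed points become truth constants.
module Submission where

open import Level using (0ℓ)
open import Axiom.ExcludedMiddle using (ExcludedMiddle)
open import Axiom.DoubleNegationElimination using (em⇒dne)
open import Data.Bool using (Bool; true; false; T)
open import Data.Empty using (⊥-elim; ⊥-elim-irr)
open import Data.Fin using (Fin; zero; suc; lift; punchIn) renaming (_≟_ to _≟ᶠ_)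
open import Data.List using (List; []; _∷_; _++_; foldr; allFin; cartesianProductWith)
open import Data.List.Membership.Propositional using (_∈_; lose)
open import Data.List.Membership.Propositional.Properties using (∈-cartesianProductWith⁺)
open import Data.List.Relation.Unary.All as All using (All; []; _∷_)
open import Data.List.Relation.Unary.All.Properties as Allₚ using (++⁻ˡ; ++⁻ʳ)
open import Data.List.Relation.Unary.Any using (Any; here; there; satisfied)
import Data.List.Relation.Unary.Any.Properties as Anyₚ
open import Data.Nat using (ℕ; zero; suc)
open import Data.Product using (Σ; ∃; _×_; _,_)
open import Data.Product.Function.NonDependent.Propositional using (_×-⇔_)
open import Data.Sum using (_⊎_; inj₁; inj₂; [_,_])
open import Data.Sum.Function.Propositional using (_⊎-⇔_)
open import Function using (_∘_; id)
open import Function.Bundles using (_⇔_; mk⇔; Equivalence)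
open import Function.Construct.Composition using () renaming (equivalence to ⇔-trans)
open import Function.Construct.Identity using (⇔-id)
open import Function.Construct.Symmetry using (⇔-sym)
open import Function.Definitions using (Injective)
open import Function.Related.TypeIsomorphisms using (¬-cong-⇔)
open import Relation.Binary.Definitions using (DecidableEquality)
open import Relation.Binary.PropositionalEquality using (_≡_; _≢_; refl; sym; trans; cong; subst)
open import Relation.Nullary using (Dec; yes; no; isYes)
open import Relation.Nullary.Decidable using (T?; toWitness; fromWitness)

open import Defs

open Equivalence using (to; from)

≡⇒⇔ : ∀ {A B : Set} → A ≡ B → A ⇔ B
≡⇒⇔ refl = ⇔-id _

All-cong : ∀ {A : Set} {P Q : A → Set} {xs : List A} →
  (∀ {x} → P x ⇔ Q x) → All P xs ⇔ All Q xs
All-cong P⇔Q = mk⇔ (All.map (to P⇔Q)) (All.map (from P⇔Q))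

val-injective : ∀ {A : Set} {t : A} → Injective _≡_ _≡_ (val {t = t})
val-injective {x = ⟨ _ , _ ⟩} {⟨ _ , _ ⟩} refl = refl

stay : ∀ {A : Set} {s t : A} → t ≢ s → Other t
stay {s = s} t≢s = ⟨ s , t≢s ∘ sym ⟩

swap₀₁ : ∀ {n} → Fin (suc (suc n)) → Fin (suc (suc n))
swap₀₁ zero          = suc zero
swap₀₁ (suc zero)    = zero
swap₀₁ (suc (suc i)) = suc (suc i)

module _ {Sig : Set} where

  ⊤' : ∀ {e n} → FO Sig e n
  ⊤' = ¬' ⊥'

  infixr 6 _∧'_
  _∧'_ : ∀ {e n} → FO Sig e n → FO Sig e n → FO Sig e n
  φ ∧' ψ = ¬' ((¬' φ) ∨' (¬' ψ))

  ⋀ : ∀ {e n} {A : Set} → List A → (A → FO Sig e n) → FO Sig e n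
  ⋀ xs φ = foldr (λ x ψ → φ x ∧' ψ) ⊤' xs

  ren : ∀ {e m n} → (Fin m → Fin n) → FO Sig e m → FO Sig e n
  ren f ⊥'         = ⊥'
  ren f (pred p i) = pred p (f i)
  ren f (i ≐ j)    = f i ≐ f j
  ren f (¬' φ)     = ¬' ren f φ
  ren f (φ ∨' ψ)   = ren f φ ∨' ren f ψ
  ren f (∃' φ)     = ∃' (ren (lift 1 f) φ)

  ren-sem : ∀ {e m n} (φ : FO Sig e m) (f : Fin m → Fin n) (M : Structure Sig)
    (ρ : Fin m → W M) (ρ′ : Fin n → W M) →
    (∀ i → ρ′ (f i) ≡ ρ i) → ⟦ ren f φ ⟧ M ρ′ ⇔ ⟦ φ ⟧ M ρ
  ren-sem ⊥'         f M ρ ρ′ ρ′∘f≡ρ = ⇔-id _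
  ren-sem (pred p i) f M ρ ρ′ ρ′∘f≡ρ = ≡⇒⇔ (cong (P M p) (ρ′∘f≡ρ i))
  ren-sem (i ≐ j)    f M ρ ρ′ ρ′∘f≡ρ =
    mk⇔ (λ e → trans (sym (ρ′∘f≡ρ i)) (trans e (ρ′∘f≡ρ j)))
        (λ e → trans (ρ′∘f≡ρ i) (trans e (sym (ρ′∘f≡ρ j))))
  ren-sem (¬' φ)     f M ρ ρ′ ρ′∘f≡ρ = ¬-cong-⇔ (ren-sem φ f M ρ ρ′ ρ′∘f≡ρ)
  ren-sem (φ ∨' ψ)   f M ρ ρ′ ρ′∘f≡ρ = ren-sem φ f M ρ ρ′ ρ′∘f≡ρ ⊎-⇔ ren-sem ψ f M ρ ρ′ ρ′∘f≡ρ
  ren-sem (∃' φ)     f M ρ ρ′ ρ′∘f≡ρ =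
    mk⇔ (λ (w , d) → w , to (body w) d) (λ (w , d) → w , from (body w) d)
    where
    body : ∀ w → ⟦ ren (lift 1 f) φ ⟧ M (w ∷ᵉ ρ′) ⇔ ⟦ φ ⟧ M (w ∷ᵉ ρ)
    body w = ren-sem φ (lift 1 f) M (w ∷ᵉ ρ) (w ∷ᵉ ρ′) λ { zero → refl ; (suc i) → ρ′∘f≡ρ i }

  record Removal (M N : Structure Sig) (k : ℕ) : Set₁ where
    field
      inc             : W N → W M
      inc-injective   : Injective _≡_ _≡_ inc
      inc-pred        : ∀ p w → P N p w ≡ P M p (inc w)
      point           : Fin k → W M
      point-injective : Injective _≡_ _≡_ point
      inc≢point       : ∀ w i → inc w ≢ point i
      covers          : ∀ m → (∃ λ w → m ≡ inc w) ⊎ (∃ λ i → m ≡ point i)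

    -- The variable convention of both translations: index zero is x, suc i the i-th removed point.
    assignment : W N → Fin (suc k) → W M
    assignment s = inc s ∷ᵉ point

    assignment-injective : ∀ s → Injective _≡_ _≡_ (assignment s)
    assignment-injective s {zero}  {zero}  e = refl
    assignment-injective s {zero}  {suc j} e = ⊥-elim (inc≢point s j e)
    assignment-injective s {suc i} {zero}  e = ⊥-elim (inc≢point s i (sym e))
    assignment-injective s {suc i} {suc j} e = cong suc (point-injective e)

    fresh≢assigned : ∀ {s w} → .(w ≢ s) → ∀ i → inc w ≢ assignment s i
    fresh≢assigned w≢s zero    e = ⊥-elim-irr (w≢s (inc-injective e))
    fresh≢assigned w≢s (suc i) e = inc≢point _ i e

    unremoved⇒inc : ∀ {m} → (∀ i → m ≢ point i) → ∃ λ w → m ≡ inc w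
    unremoved⇒inc {m} m≢point with covers m
    ... | inj₁ m∈N       = m∈N
    ... | inj₂ (i , m≡i) = ⊥-elim (m≢point i m≡i)

  open Removal

  noRemoval : (M : Structure Sig) → Removal M M 0
  noRemoval M = record
    { inc             = id
    ; inc-injective   = id
    ; inc-pred        = λ _ _ → refl
    ; point           = λ ()
    ; point-injective = λ { {()} }
    ; inc≢point       = λ _ ()
    ; covers          = λ m → inj₁ (m , refl)
    }

  distinctFrom : ∀ {k m} → (Fin k → Fin m) → FO Sig true (suc m)
  distinctFrom {k} g = ⋀ (allFin k) (λ i → ¬' (zero ≐ suc (g i)))

  -- Relativisation of φ to N: f places the variables of φ, and the removed
  -- points are held by the variables g i, which every quantifier must avoid.
  relativize : ∀ {e n m k} → (Fin n → Fin m) → (Fin k → Fin m) → FO Sig e n → FO Sig true m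
  relativize f g ⊥'         = ⊥'
  relativize f g (pred p i) = pred p (f i)
  relativize f g (i ≐ j)    = f i ≐ f j
  relativize f g (¬' φ)     = ¬' relativize f g φ
  relativize f g (φ ∨' ψ)   = relativize f g φ ∨' relativize f g ψ
  relativize f g (∃' φ)     = ∃' (distinctFrom g ∧' relativize (lift 1 f) (suc ∘ g) φ)

  toFO : ∀ {k} → L Sig → FO Sig true (suc k)
  toFO (base φ)    = relativize (λ _ → zero) suc φ
  toFO (¬L φ)      = ¬' toFO φ
  toFO (φ ∨L ψ)    = toFO φ ∨' toFO ψ
  toFO (⟨- φ ⟩ ψ) =
    ∃' (distinctFrom id ∧' ren (punchIn (suc zero)) (toFO φ) ∧' ren swap₀₁ (toFO ψ))

module _ (em : ExcludedMiddle 0ℓ) {Sig : Set} where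

  open Removal

  ∧'-sem : ∀ {e n} (φ ψ : FO Sig e n) {M : Structure Sig} {ρ : Fin n → W M} →
    ⟦ φ ∧' ψ ⟧ M ρ ⇔ (⟦ φ ⟧ M ρ × ⟦ ψ ⟧ M ρ)
  ∧'-sem φ ψ = mk⇔ (λ h → em⇒dne em (h ∘ inj₁) , em⇒dne em (h ∘ inj₂))
                   (λ (a , b) → [ (λ ¬a → ¬a a) , (λ ¬b → ¬b b) ])

  ⋀-sem : ∀ {e n} {A : Set} (xs : List A) (φ : A → FO Sig e n) {M : Structure Sig}
    {ρ : Fin n → W M} → ⟦ ⋀ xs φ ⟧ M ρ ⇔ All (λ x → ⟦ φ x ⟧ M ρ) xs
  ⋀-sem []       φ = mk⇔ (λ _ → []) (λ _ ())
  ⋀-sem (x ∷ xs) φ = ⇔-trans (∧'-sem (φ x) (⋀ xs φ))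
    (mk⇔ (λ (a , as) → a ∷ to (⋀-sem xs φ) as) (λ { (a ∷ as) → a , from (⋀-sem xs φ) as }))

  distinctFrom-sem : ∀ {k m} (g : Fin k → Fin m) {M : Structure Sig} {ρ : Fin (suc m) → W M} →
    ⟦ distinctFrom {Sig} g ⟧ M ρ ⇔ (∀ i → ρ zero ≢ ρ (suc (g i)))
  distinctFrom-sem {k} g =
    ⇔-trans (⋀-sem (allFin k) (λ i → ¬' (zero ≐ suc (g i)))) (mk⇔ Allₚ.tabulate⁻ Allₚ.tabulate⁺)

  assigned⊎fresh : ∀ {M N : Structure Sig} {k} (st : Removal M N k) (s : W N) (m : W M) →
    (∃ λ i → m ≡ assignment st s i) ⊎ (∃ λ w → w ≢ s × m ≡ inc st w)
  assigned⊎fresh st s m with covers st m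
  ... | inj₂ (i , m≡i) = inj₁ (suc i , m≡i)
  ... | inj₁ (w , m≡w) with em {w ≡ s}
  ...   | yes refl = inj₁ (zero , m≡w)
  ...   | no w≢s   = inj₂ (w , w≢s , m≡w)

  unassigned⇒fresh : ∀ {M N : Structure Sig} {k} (st : Removal M N k) (s : W N) {m : W M} →
    (∀ i → m ≢ assignment st s i) → ∃ λ w → w ≢ s × m ≡ inc st w
  unassigned⇒fresh st s {m} m≢assigned with assigned⊎fresh st s m
  ... | inj₁ (i , m≡i) = ⊥-elim (m≢assigned i m≡i)
  ... | inj₂ fresh     = fresh

  -- Removing t from N moves it from the image of `inc` to the points, so the
  -- new list of points is the old assignment at t.
  remove : ∀ {M N : Structure Sig} {k} → Removal M N k → (t : W N) → Removal M (N - t) (suc k)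
  remove st t = record
    { inc             = inc st ∘ val
    ; inc-injective   = val-injective ∘ inc-injective st
    ; inc-pred        = λ p w → inc-pred st p (val w)
    ; point           = assignment st t
    ; point-injective = assignment-injective st t
    ; inc≢point       = λ { ⟨ w , w≢t ⟩ → fresh≢assigned st w≢t }
    ; covers          = covers′
    }
    where
    covers′ : ∀ m → (∃ λ w → m ≡ inc st (val w)) ⊎ (∃ λ i → m ≡ assignment st t i)
    covers′ m with assigned⊎fresh st t m
    ... | inj₁ assigned          = inj₂ assigned
    ... | inj₂ (w , w≢t , m≡w) = inj₁ (⟨ w , w≢t ⟩ , m≡w)

  assignment-remove : ∀ {M N : Structure Sig} {k} (st : Removal M N k) {s t : W N} (t≢s : t ≢ s) i →
    assignment (remove st t) (stay t≢s) (punchIn (suc zero) i) ≡ assignment st s i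
  assignment-remove st t≢s zero    = refl
  assignment-remove st t≢s (suc i) = refl

  relativize-sem : ∀ {M N : Structure Sig} {k e n m} (st : Removal M N k) (φ : FO Sig e n)
    (f : Fin n → Fin m) (g : Fin k → Fin m) (ρ : Fin m → W M) (σ : Fin n → W N) →
    (∀ j → ρ (f j) ≡ inc st (σ j)) → (∀ i → ρ (g i) ≡ point st i) →
    ⟦ relativize f g φ ⟧ M ρ ⇔ ⟦ φ ⟧ N σ
  relativize-sem st ⊥'         f g ρ σ ρ∘f≡ ρ∘g≡ = ⇔-id _
  relativize-sem {M} st (pred p i) f g ρ σ ρ∘f≡ ρ∘g≡ =
    ≡⇒⇔ (trans (cong (P M p) (ρ∘f≡ i)) (sym (inc-pred st p (σ i))))
  relativize-sem st (i ≐ j)    f g ρ σ ρ∘f≡ ρ∘g≡ =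
    mk⇔ (λ e → inc-injective st (trans (sym (ρ∘f≡ i)) (trans e (ρ∘f≡ j))))
        (λ e → trans (ρ∘f≡ i) (trans (cong (inc st) e) (sym (ρ∘f≡ j))))
  relativize-sem st (¬' φ)     f g ρ σ ρ∘f≡ ρ∘g≡ =
    ¬-cong-⇔ (relativize-sem st φ f g ρ σ ρ∘f≡ ρ∘g≡)
  relativize-sem st (φ ∨' ψ)   f g ρ σ ρ∘f≡ ρ∘g≡ =
    relativize-sem st φ f g ρ σ ρ∘f≡ ρ∘g≡ ⊎-⇔ relativize-sem st ψ f g ρ σ ρ∘f≡ ρ∘g≡
  relativize-sem {M} {N} st (∃' φ) f g ρ σ ρ∘f≡ ρ∘g≡ = mk⇔ to′ from′
    where
    body : ∀ w m → m ≡ inc st w →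
      ⟦ relativize (lift 1 f) (suc ∘ g) φ ⟧ M (m ∷ᵉ ρ) ⇔ ⟦ φ ⟧ N (w ∷ᵉ σ)
    body w m m≡w = relativize-sem st φ (lift 1 f) (suc ∘ g) (m ∷ᵉ ρ) (w ∷ᵉ σ)
                     (λ { zero → m≡w ; (suc j) → ρ∘f≡ j }) ρ∘g≡
    to′ : ⟦ ∃' (distinctFrom g ∧' relativize (lift 1 f) (suc ∘ g) φ) ⟧ M ρ → ⟦ ∃' φ ⟧ N σ
    to′ (m , d) with to (∧'-sem (distinctFrom g) (relativize (lift 1 f) (suc ∘ g) φ)) d
    ... | m≢g , b
      with unremoved⇒inc st (λ i e → to (distinctFrom-sem g) m≢g i (trans e (sym (ρ∘g≡ i))))
    ...   | w , m≡w = w , to (body w m m≡w) b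
    from′ : ⟦ ∃' φ ⟧ N σ → ⟦ ∃' (distinctFrom g ∧' relativize (lift 1 f) (suc ∘ g) φ) ⟧ M ρ
    from′ (w , d) = inc st w , from (∧'-sem (distinctFrom g) (relativize (lift 1 f) (suc ∘ g) φ))
      ( from (distinctFrom-sem g) (λ i e → inc≢point st w i (trans e (ρ∘g≡ i)))
      , from (body w (inc st w) refl) d )

  toFO-sem : ∀ {M N : Structure Sig} {k} (φ : L Sig) (st : Removal M N k) (s : W N)
    (ρ : Fin (suc k) → W M) →
    (∀ i → ρ i ≡ assignment st s i) → (N , s ⊨ φ) ⇔ ⟦ toFO φ ⟧ M ρ
  toFO-sem (base φ) st s ρ ρ≡ =
    ⇔-sym (relativize-sem st φ (λ _ → zero) suc ρ (λ _ → s) (λ _ → ρ≡ zero) (ρ≡ ∘ suc))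
  toFO-sem (¬L φ)   st s ρ ρ≡ = ¬-cong-⇔ (toFO-sem φ st s ρ ρ≡)
  toFO-sem (φ ∨L ψ) st s ρ ρ≡ = toFO-sem φ st s ρ ρ≡ ⊎-⇔ toFO-sem ψ st s ρ ρ≡
  toFO-sem {M} {N} {k} (⟨- φ ⟩ ψ) st s ρ ρ≡ = mk⇔ to′ from′
    where
    Φ : FO Sig true (suc (suc k))
    Φ = ren (punchIn (suc zero)) (toFO φ)
    Ψ : FO Sig true (suc (suc k))
    Ψ = ren swap₀₁ (toFO ψ)
    sides : ∀ (t : W N) (t≢s : t ≢ s) (m : W M) → m ≡ inc st t →
      ((N , t ⊨ φ) × ((N - t) , stay t≢s ⊨ ψ)) ⇔ (⟦ Φ ⟧ M (m ∷ᵉ ρ) × ⟦ Ψ ⟧ M (m ∷ᵉ ρ))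
    sides t t≢s m m≡t =
      ⇔-trans (toFO-sem φ st t ρφ (λ { zero → m≡t ; (suc i) → ρ≡ (suc i) }))
              (⇔-sym (ren-sem (toFO φ) _ M ρφ (m ∷ᵉ ρ) (λ _ → refl)))
      ×-⇔
      ⇔-trans (toFO-sem ψ (remove st t) (stay t≢s) ρψ
                 (λ { zero → ρ≡ zero ; (suc zero) → m≡t ; (suc (suc i)) → ρ≡ (suc i) }))
              (⇔-sym (ren-sem (toFO ψ) _ M ρψ (m ∷ᵉ ρ) (λ _ → refl)))
      where
      ρφ : Fin (suc k) → W M
      ρφ = (m ∷ᵉ ρ) ∘ punchIn (suc zero)
      ρψ : Fin (suc (suc k)) → W M
      ρψ = (m ∷ᵉ ρ) ∘ swap₀₁
    to′ : N , s ⊨ (⟨- φ ⟩ ψ) → ⟦ toFO (⟨- φ ⟩ ψ) ⟧ M ρ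
    to′ (t , t≢s , a , b) = inc st t , from (∧'-sem (distinctFrom id) (Φ ∧' Ψ))
      ( from (distinctFrom-sem id) (λ i e → fresh≢assigned st t≢s i (trans e (ρ≡ i)))
      , from (∧'-sem Φ Ψ) (to (sides t t≢s (inc st t) refl) (a , b)) )
    from′ : ⟦ toFO (⟨- φ ⟩ ψ) ⟧ M ρ → N , s ⊨ (⟨- φ ⟩ ψ)
    from′ (m , d) with to (∧'-sem (distinctFrom id) (Φ ∧' Ψ)) d
    ... | m≢ρ , ab
      with unassigned⇒fresh st s (λ i e → to (distinctFrom-sem id) m≢ρ i (trans e (sym (ρ≡ i))))
    ...   | t , t≢s , m≡t = t , t≢s , from (sides t t≢s m m≡t) (to (∧'-sem Φ Ψ) ab)

Colour : Set → Set
Colour Sig = Sig → Bool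

module _ {Sig : Set} where

  decideL : ∀ {A : Set} → Dec A → L Sig
  decideL (yes _) = base ⊤'
  decideL (no _)  = base ⊥'

  decideL-sem : ∀ {A : Set} (d : Dec A) {N : Structure Sig} (s : W N) → (N , s ⊨ decideL d) ⇔ A
  decideL-sem (yes a) s = mk⇔ (λ _ → a) (λ _ ())
  decideL-sem (no ¬a) s = mk⇔ (λ ()) ¬a

  ⋁ : ∀ {A : Set} → List A → (A → L Sig) → L Sig
  ⋁ xs φ = foldr (λ x ψ → φ x ∨L ψ) (base ⊥') xs

  ⋁-sem : ∀ {A : Set} (xs : List A) (φ : A → L Sig) {N : Structure Sig} (s : W N) →
    (N , s ⊨ ⋁ xs φ) ⇔ Any (λ x → N , s ⊨ φ x) xs
  ⋁-sem []       φ s = mk⇔ (λ ()) (λ ())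
  ⋁-sem (x ∷ xs) φ s = mk⇔
    [ here , there ∘ to (⋁-sem xs φ s) ]
    (λ { (here a) → inj₁ a ; (there as) → inj₂ (from (⋁-sem xs φ s) as) })

  Realises : (M : Structure Sig) → W M → List Sig → Colour Sig → Set
  Realises M w S f = All (λ q → P M q w ⇔ T (f q)) S

  literal : Bool → Sig → FO Sig false 1
  literal true  p = pred p zero
  literal false p = ¬' pred p zero

  literal-sem : ∀ b p {M : Structure Sig} (ρ : Fin 1 → W M) →
    ⟦ literal b p ⟧ M ρ ⇔ (P M p (ρ zero) ⇔ T b)
  literal-sem true  p ρ = mk⇔ (λ a → mk⇔ _ (λ _ → a)) (λ h → from h _)
  literal-sem false p ρ = mk⇔ (λ ¬a → mk⇔ ¬a λ ()) to

  colourFormula : List Sig → Colour Sig → FO Sig false 1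
  colourFormula S f = ⋀ S (λ q → literal (f q) q)

  predicates : ∀ {e n} → FO Sig e n → List Sig
  predicates ⊥'         = []
  predicates (pred p i) = p ∷ []
  predicates (i ≐ j)    = []
  predicates (¬' φ)     = predicates φ
  predicates (φ ∨' ψ)   = predicates φ ++ predicates ψ
  predicates (∃' φ)     = predicates φ

  atom : ∀ {k} → (Fin k → Colour Sig) → Sig → Fin (suc k) → L Sig
  atom cs p zero    = base (pred p zero)
  atom cs p (suc i) = decideL (T? (cs i p))

  open Removal

  atom-sem : ∀ {M N : Structure Sig} {k} (st : Removal M N k) (s : W N)
    (cs : Fin k → Colour Sig) p r → (∀ i → P M p (point st i) ⇔ T (cs i p)) →
    (N , s ⊨ atom cs p r) ⇔ P M p (assignment st s r)
  atom-sem st s cs p zero    real = ≡⇒⇔ (inc-pred st p s)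
  atom-sem st s cs p (suc i) real = ⇔-trans (decideL-sem (T? (cs i p)) s) (⇔-sym (real i))

module _ {Sig : Set} (_≟_ : DecidableEquality Sig) where

  update : Sig → Bool → Colour Sig → Colour Sig
  update p b f q with q ≟ p
  ... | yes _ = b
  ... | no _  = f q

  update-agrees : ∀ p f (g : Colour Sig) q → (q ≢ p → f q ≡ g q) → update p (g p) f q ≡ g q
  update-agrees p f g q agree with q ≟ p
  ... | yes refl = refl
  ... | no q≢p   = agree q≢p

  colourings : List Sig → List (Colour Sig)
  colourings []      = (λ _ → false) ∷ []
  colourings (p ∷ S) = cartesianProductWith (update p) (true ∷ false ∷ []) (colourings S)

  colourings-complete : ∀ S (g : Colour Sig) →
    ∃ λ f → f ∈ colourings S × All (λ q → f q ≡ g q) S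
  colourings-complete []      g = _ , here refl , []
  colourings-complete (p ∷ S) g with colourings-complete S g
  ... | f , f∈ , agree =
    update p (g p) f ,
    ∈-cartesianProductWith⁺ (update p) (bool∈ (g p)) f∈ ,
    update-agrees p f g p (λ p≢p → ⊥-elim (p≢p refl)) ∷
    All.map (λ {q} fq≡gq → update-agrees p f g q (λ _ → fq≡gq)) agree
    where
    bool∈ : ∀ b → b ∈ true ∷ false ∷ []
    bool∈ true  = here refl
    bool∈ false = there (here refl)

  -- A variable of θ is sent by env to x (index zero) or to the i-th removed
  -- point, whose colour on the predicates of θ is cs i.  A witness of ∃' θ is
  -- one of these, or a fresh point, which ⟨-_⟩ removes after fixing its colour.
  toL : ∀ {k m} → (Fin k → Colour Sig) → (Fin m → Fin (suc k)) → FO Sig true m → L Sig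
  toL cs env ⊥'         = base ⊥'
  toL cs env (pred p v) = atom cs p (env v)
  toL cs env (v ≐ w)    = decideL (env v ≟ᶠ env w)
  toL cs env (¬' θ)     = ¬L toL cs env θ
  toL cs env (θ ∨' ψ)   = toL cs env θ ∨L toL cs env ψ
  toL {k} cs env (∃' θ) =
    ⋁ (allFin (suc k)) (λ i → toL cs (i ∷ᵉ env) θ) ∨L
    ⋁ (colourings (predicates θ)) (λ f →
      ⟨- base (colourFormula (predicates θ) f) ⟩
        toL (f ∷ᵉ cs) (suc zero ∷ᵉ (punchIn (suc zero) ∘ env)) θ)

module _ (em : ExcludedMiddle 0ℓ) {Sig : Set} where

  open Removal

  colourFormula-sem : ∀ S f {M : Structure Sig} (t : W M) →
    ⟦ colourFormula S f ⟧ M (λ _ → t) ⇔ Realises M t S f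
  colourFormula-sem S f t =
    ⇔-trans (⋀-sem em S (λ q → literal (f q) q)) (All-cong λ {q} → literal-sem (f q) q (λ _ → t))

  realises-inc : ∀ {M N : Structure Sig} {k} (st : Removal M N k) w S f →
    Realises N w S f ⇔ Realises M (inc st w) S f
  realises-inc st w S f = All-cong λ {q} → ≡⇒⇔ (cong (_⇔ T (f q)) (inc-pred st q w))

  colourOf : (M : Structure Sig) → W M → Colour Sig
  colourOf M m q = isYes (em {P M q m})

  realises-agreeing : ∀ {M : Structure Sig} (m : W M) S f →
    All (λ q → f q ≡ colourOf M m q) S → Realises M m S f
  realises-agreeing {M} m S f = All.map λ {q} f≡ →
    subst (λ b → P M q m ⇔ T b) (sym f≡) (mk⇔ fromWitness toWitness)

  module _ (_≟_ : DecidableEquality Sig) where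

    colourings-cover : ∀ S {N : Structure Sig} (t : W N) →
      ∃ λ f → f ∈ colourings _≟_ S × ⟦ colourFormula S f ⟧ N (λ _ → t)
    colourings-cover S {N} t with colourings-complete _≟_ S (colourOf N t)
    ... | f , f∈ , agree =
      f , f∈ , from (colourFormula-sem S f t) (realises-agreeing {N} t S f agree)

    toL-sem : ∀ {M N : Structure Sig} {k m} (θ : FO Sig true m) (st : Removal M N k) (s : W N)
      (cs : Fin k → Colour Sig) (env : Fin m → Fin (suc k)) (ρ : Fin m → W M) →
      (∀ v → ρ v ≡ assignment st s (env v)) →
      (∀ i → Realises M (point st i) (predicates θ) (cs i)) →
      (N , s ⊨ toL _≟_ cs env θ) ⇔ ⟦ θ ⟧ M ρ
    toL-sem ⊥' st s cs env ρ ρ≡ coloured = ⇔-id _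
    toL-sem {M} (pred p v) st s cs env ρ ρ≡ coloured =
      ⇔-trans (atom-sem st s cs p (env v) (All.head ∘ coloured))
              (≡⇒⇔ (cong (P M p) (sym (ρ≡ v))))
    toL-sem (v ≐ w) st s cs env ρ ρ≡ coloured =
      ⇔-trans (decideL-sem (env v ≟ᶠ env w) s)
        (mk⇔ (λ e → trans (ρ≡ v) (trans (cong (assignment st s) e) (sym (ρ≡ w))))
             (λ e → assignment-injective st s (trans (sym (ρ≡ v)) (trans e (ρ≡ w)))))
    toL-sem (¬' θ) st s cs env ρ ρ≡ coloured = ¬-cong-⇔ (toL-sem θ st s cs env ρ ρ≡ coloured)
    toL-sem (θ ∨' ψ) st s cs env ρ ρ≡ coloured =
      toL-sem θ st s cs env ρ ρ≡ (++⁻ˡ _ ∘ coloured)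
        ⊎-⇔ toL-sem ψ st s cs env ρ ρ≡ (++⁻ʳ (predicates θ) ∘ coloured)
    toL-sem {M} {N} {k} (∃' θ) st s cs env ρ ρ≡ coloured = mk⇔ to′ from′
      where
      S : List Sig
      S = predicates θ
      old : ∀ i m → m ≡ assignment st s i →
        (N , s ⊨ toL _≟_ cs (i ∷ᵉ env) θ) ⇔ ⟦ θ ⟧ M (m ∷ᵉ ρ)
      old i m m≡i =
        toL-sem θ st s cs (i ∷ᵉ env) (m ∷ᵉ ρ) (λ { zero → m≡i ; (suc v) → ρ≡ v }) coloured
      new : ∀ f (t : W N) (t≢s : t ≢ s) → ⟦ colourFormula S f ⟧ N (λ _ → t) → ∀ m → m ≡ inc st t →
        ((N - t) , stay t≢s ⊨ toL _≟_ (f ∷ᵉ cs) (suc zero ∷ᵉ (punchIn (suc zero) ∘ env)) θ)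
          ⇔ ⟦ θ ⟧ M (m ∷ᵉ ρ)
      new f t t≢s c m m≡t = toL-sem θ (remove em st t) (stay t≢s) (f ∷ᵉ cs) _ (m ∷ᵉ ρ)
        (λ { zero → m≡t ; (suc v) → trans (ρ≡ v) (sym (assignment-remove em st t≢s (env v))) })
        (λ { zero    → to (realises-inc st t S f) (to (colourFormula-sem S f t) c)
           ; (suc i) → coloured i })
      to′ : N , s ⊨ toL _≟_ cs env (∃' θ) → ⟦ ∃' θ ⟧ M ρ
      to′ (inj₁ d) with Anyₚ.tabulate⁻ (to (⋁-sem (allFin (suc k)) _ s) d)
      ... | i , dᵢ = assignment st s i , to (old i _ refl) dᵢ
      to′ (inj₂ d) with satisfied (to (⋁-sem (colourings _≟_ S) _ s) d)
      ... | f , t , t≢s , c , dₜ = inc st t , to (new f t t≢s c _ refl) dₜ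
      from′ : ⟦ ∃' θ ⟧ M ρ → N , s ⊨ toL _≟_ cs env (∃' θ)
      from′ (m , d) with assigned⊎fresh em st s m
      ... | inj₁ (i , m≡i) =
        inj₁ (from (⋁-sem _ _ s) (Anyₚ.tabulate⁺ {f = id} i (from (old i m m≡i) d)))
      ... | inj₂ (t , t≢s , m≡t) with colourings-cover S t
      ...   | f , f∈ , c =
        inj₂ (from (⋁-sem _ _ s) (lose f∈ (t , t≢s , c , from (new f t t≢s c m m≡t) d)))

mainTheorem8 : ExcludedMiddle 0ℓ → (Sig : Set) →
    ((φ : L Sig) → Σ (FO Sig true 1) (λ χ → φ ≋ χ))
    × ((χ : FO Sig true 1) → Σ (L Sig) (λ φ → φ ≋ χ))
mainTheorem8 em Sig =
  (λ φ → toFO φ , λ M s → toFO-sem em φ (noRemoval M) s (λ _ → s) λ { zero → refl })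
  , (λ χ → toL _≟_ (λ ()) (λ _ → zero) χ ,
       λ M s → toL-sem em _≟_ χ (noRemoval M) s _ (λ _ → zero) (λ _ → s) (λ _ → refl) (λ ()))
  where
  _≟_ : DecidableEquality Sig
  _ ≟ _ = em
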